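{- Let $\mathbb X=\langle X,\le\rangle$ be a partial order with $\mathbb X=\sum_{\mathbb I}\mathbb X_i$, where $\mathbb I=\langle n,\le_{\mathbb I}\rangle$ is a finite partial order on $n=\{0,\dots,n-1\}$, the $\mathbb X_i=\langle X_i,\le_i\rangle$ ($i<n$) are pairwise disjoint partial orders, and each $\mathbb X_i$ has a largest element $r_i=\max\mathbb X_i$. Put $\bar r=\langle r_0,\dots,r_{n-1}\rangle$. For $i<n$ let $\varphi_i(w_0,\dots,w_{n-1},v)$ be the $L_b$-formula $$v\le w_i\ \wedge\ \bigwedge_{j<_{\mathbb I}i} w_j<v\ \wedge\ \bigwedge_{j>_{\mathbb I}i} w_j>v\ \wedge\ \bigwedge_{j\ \text{incomparable to}\ i\ \text{in}\ \mathbb I}\big(\neg\, w_j\le v\wedge\neg\, v\le w_j\big),$$ and for a structure $\mathbb Y$ and $\bar a\in Y^n$ let $D_{\varphi_i(\bar a,v),\mathbb Y}=\{y\in Y:\mathbb Y\models\varphi_i[\bar a,y]\}$. Then: (a) $X_i=D_{\varphi_i(\bar r,v),\mathbb X}$ for each $i<n$; (b) the formula $\varepsilon(\bar r,u,v)=\bigvee_{i<n}(\varphi_i(\bar r,u)\wedge\varphi_i(\bar r,v))$ defines in $\mathbb X$ an equivalence relation on $X$ whose set of equivalence classes is $\{X_i:i<n\}$; (c) if $\mathbb Y\equiv\mathbb X$ and $\tau_i\in\mathrm{Th}(\mathbb X_i)$ for $i<n$, then there is $\bar r'=\langle r'_0,\dots,r'_{n-1}\rangle\in Y^n$ such that, setting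 $Y_i:=D_{\varphi_i(\bar r',v),\mathbb Y}$ for $i<n$ and $\mathbb Y_i$ the induced suborder on $Y_i$: (i) $\{Y_i:i<n\}$ is a partition of $Y$ and it is the set of classes of the equivalence relation defined in $\mathbb Y$ by $\varepsilon(\bar r',u,v)$; (ii) $\mathbb Y=\sum_{\mathbb I}\mathbb Y_i$ and $r'_i=\max\mathbb Y_i$ for each $i<n$; (iii) $\mathbb Y_i\models\tau_i$ for each $i<n$.
   Context: $L_b=\langle\le\rangle$ is the language of partial orders. Lexicographic sum: for a partial order $\mathbb I=\langle I,\le_{\mathbb I}\rangle$ and partial orders $\mathbb X_i$ ($i\in I$) with pairwise disjoint domains, $\sum_{\mathbb I}\mathbb X_i$ is the partial order on $X=\bigcup_{i\in I}X_i$ in which $x\le x'$ iff either $x,x'\in X_i$ for some $i$ and $x\le_{\mathbb X_i}x'$, or $x\in X_i$, $x'\in X_j$ for some $i,j$ with $i<_{\mathbb I}j$ (i.e. $i\le_{\mathbb I}j$, $i\ne j$). Here $w_j<v$ abbreviates $w_j\le v\wedge w_j\neq v$. -}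

module Defs where

open import Data.Nat using (ℕ; zero; suc)
open import Data.Fin using (Fin; zero; suc; _≟_)
open import Data.Vec.Functional using (_∷_)
open import Data.Product using (Σ; ∃; ∃₂; _×_; _,_; proj₁)
open import Data.Sum using (_⊎_)
open import Data.Empty using (⊥)
open import Relation.Nullary using (¬_; Dec; yes; no)
open import Relation.Binary.PropositionalEquality using (_≡_; _≢_)
open import Relation.Binary.Structures using (IsDecPartialOrder; IsPartialOrder)
open import Relation.Binary.Definitions using (Reflexive; Symmetric; Transitive)
open import Function.Bundles using (_⇔_)

-- An L_b-structure: carrier, interpretation of ≤, interpretation of =.
-- (For all "genuine" structures below Eq is _≡_; for induced substructures
-- on Σ-types Eq is equality of the underlying elements.)
record Str : Set₁ where
  field
    Carrier : Set
    R       : Carrier → Carrier → Set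
    Eq      : Carrier → Carrier → Set
open Str public

mkStr : (C : Set) → (C → C → Set) → Str
mkStr C r = record { Carrier = C ; R = r ; Eq = _≡_ }

data Formula (k : ℕ) : Set where
  _≤'_ _≐'_     : Fin k → Fin k → Formula k
  ⊥'            : Formula k
  ¬'_           : Formula k → Formula k
  _∧'_ _∨'_ _⇒'_ : Formula k → Formula k → Formula k
  ∀' ∃'         : Formula (suc k) → Formula k

Sentence : Set
Sentence = Formula 0

Sat : (M : Str) → ∀ {k} → Formula k → (Fin k → Carrier M) → Set
Sat M (x ≤' y) ρ = R M (ρ x) (ρ y)
Sat M (x ≐' y) ρ = Eq M (ρ x) (ρ y)
Sat M ⊥' ρ = ⊥
Sat M (¬' φ) ρ = ¬ Sat M φ ρ
Sat M (φ ∧' ψ) ρ = Sat M φ ρ × Sat M ψ ρ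
Sat M (φ ∨' ψ) ρ = Sat M φ ρ ⊎ Sat M ψ ρ
Sat M (φ ⇒' ψ) ρ = Sat M φ ρ → Sat M ψ ρ
Sat M (∀' φ) ρ = (a : Carrier M) → Sat M φ (a ∷ ρ)
Sat M (∃' φ) ρ = Σ (Carrier M) λ a → Sat M φ (a ∷ ρ)

_⊨_ : Str → Sentence → Set
M ⊨ σ = Sat M σ (λ ())

ElemEquiv : Str → Str → Set
ElemEquiv M N = (σ : Sentence) → (M ⊨ σ) ⇔ (N ⊨ σ)

liftR : ∀ {k m} → (Fin k → Fin m) → Fin (suc k) → Fin (suc m)
liftR f zero = zero
liftR f (suc i) = suc (f i)

rename : ∀ {k m} → (Fin k → Fin m) → Formula k → Formula m
rename f (x ≤' y) = f x ≤' f y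
rename f (x ≐' y) = f x ≐' f y
rename f ⊥' = ⊥'
rename f (¬' φ) = ¬' rename f φ
rename f (φ ∧' ψ) = rename f φ ∧' rename f ψ
rename f (φ ∨' ψ) = rename f φ ∨' rename f ψ
rename f (φ ⇒' ψ) = rename f φ ⇒' rename f ψ
rename f (∀' φ) = ∀' (rename (liftR f) φ)
rename f (∃' φ) = ∃' (rename (liftR f) φ)

⊤' : ∀ {k} → Formula k
⊤' = ¬' ⊥'

⋀ : ∀ {m k} → (Fin m → Formula k) → Formula k
⋀ {zero} f = ⊤'
⋀ {suc m} f = f zero ∧' ⋀ (λ j → f (suc j))

⋁ : ∀ {m k} → (Fin m → Formula k) → Formula k
⋁ {zero} f = ⊥'
⋁ {suc m} f = f zero ∨' ⋁ (λ j → f (suc j))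

IsEquivRel : {C : Set} → (C → C → Set) → Set
IsEquivRel E = Reflexive E × Symmetric E × Transitive E

ClassesAre : {C : Set} {n : ℕ} → (C → C → Set) → (Fin n → C → Set) → Set
ClassesAre {C} {n} E P =
  ((u : C) → ∃ λ (i : Fin n) → (v : C) → E u v ⇔ P i v) ×
  ((i : Fin n) → ∃ λ (u : C) → (v : C) → E u v ⇔ P i v)

IsPartition : {C : Set} {n : ℕ} → (Fin n → C → Set) → Set
IsPartition {C} {n} P =
  ((y : C) → ∃ λ (i : Fin n) → P i y) ×
  ((i j : Fin n) (y : C) → P i y → P j y → i ≡ j) ×
  ((i : Fin n) → ∃ λ (y : C) → P i y)

IsLexSumOf : {C : Set} {n : ℕ} → (Fin n → Fin n → Set) → (C → C → Set) →
             (Fin n → C → Set) → Set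
IsLexSumOf {C} {n} _≤I_ _≤_ P =
  (u v : C) → (u ≤ v) ⇔
    ((∃ λ (i : Fin n) → P i u × P i v × u ≤ v) ⊎
     (∃₂ λ (i j : Fin n) → (i ≤I j × i ≢ j) × P i u × P j v))

IsMaxOf : {C : Set} → (C → C → Set) → (C → Set) → C → Set
IsMaxOf {C} _≤_ Q r = Q r × ((y : C) → Q y → y ≤ r)

SubStr : (M : Str) → (Carrier M → Set) → Str
SubStr M Q = record
  { Carrier = Σ (Carrier M) Q
  ; R = λ a b → R M (proj₁ a) (proj₁ b)
  ; Eq = λ a b → Eq M (proj₁ a) (proj₁ b) }

module _ {n : ℕ} {_≤I_ : Fin n → Fin n → Set}
         (dpo : IsDecPartialOrder _≡_ _≤I_) where

  open IsDecPartialOrder dpo using (_≤?_)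

  -- Variables of φ_i : v = zero, w_j = suc j.
  -- clause for j (j ≢ i) according to whether j <I i, j >I i, or incomparable
  clauseD : (i j : Fin n) → Dec (j ≤I i) → Dec (i ≤I j) → Formula (suc n)
  clauseD i j (yes _) _ = (suc j ≤' zero) ∧' (¬' (suc j ≐' zero))
  clauseD i j (no _) (yes _) = (zero ≤' suc j) ∧' (¬' (zero ≐' suc j))
  clauseD i j (no _) (no _) = (¬' (suc j ≤' zero)) ∧' (¬' (zero ≤' suc j))

  clause : (i j : Fin n) → Dec (j ≡ i) → Formula (suc n)
  clause i j (yes _) = ⊤'
  clause i j (no _) = clauseD i j (j ≤? i) (i ≤? j)

  φ : Fin n → Formula (suc n)
  φ i = (zero ≤' suc i) ∧' ⋀ (λ j → clause i j (j ≟ i))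

  -- ε(w̄,u,v) = ⋁_i (φ_i(w̄,u) ∧ φ_i(w̄,v));  u = zero, v = suc zero, w_j = suc (suc j)
  σu : Fin (suc n) → Fin (suc (suc n))
  σu zero = zero
  σu (suc j) = suc (suc j)

  σv : Fin (suc n) → Fin (suc (suc n))
  σv zero = suc zero
  σv (suc j) = suc (suc j)

  ε : Formula (suc (suc n))
  ε = ⋁ (λ i → rename σu (φ i) ∧' rename σv (φ i))

  D : (M : Str) → Fin n → (Fin n → Carrier M) → Carrier M → Set
  D M i a y = Sat M (φ i) (y ∷ a)

  EpsRel : (M : Str) → (Fin n → Carrier M) → Carrier M → Carrier M → Set
  EpsRel M a u v = Sat M ε (u ∷ v ∷ a)

  data SumLe (Xs : Fin n → Set) (le : ∀ i → Xs i → Xs i → Set) :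
             Σ (Fin n) Xs → Σ (Fin n) Xs → Set where
    same : ∀ {i x x'} → le i x x' → SumLe Xs le (i , x) (i , x')
    less : ∀ {i j x y} → i ≤I j → i ≢ j → SumLe Xs le (i , x) (j , y)

  SumStr : (Xs : Fin n → Set) → (∀ i → Xs i → Xs i → Set) → Str
  SumStr Xs le = mkStr (Σ (Fin n) Xs) (SumLe Xs le)

{-# OPTIONS --safe #-}
-- In the lexicographic sum, φ_i(r̄, ·) cuts out exactly X_i: an element of X_i lies below r_i and
-- sits relative to each r_j as block i sits relative to block j in 𝕀, while the maximality of r_j
-- in X_j rules out every other block. That the sets φ_i(w̄, ·) partition the universe, contain
-- w_i, are ordered among each other as dictated by 𝕀, and satisfy τ_i (by relativisation to φ_i)
-- is expressed by a single formula θ(w̄). It holds of r̄ in X, so ∃w̄ θ holds in Y, and any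
-- witness r' decomposes Y; r'_i is the largest element of its block because φ_i(w̄, v) contains
-- the conjunct v ≤ w_i.
module Submission where

open import Defs
open import Level using (0ℓ)
open import Data.Nat using (ℕ; zero; suc; _+_)
open import Data.Fin using (Fin; zero; suc; _≟_; _↑ˡ_; _↑ʳ_)
open import Data.Fin.Properties using (∀-cons-⇔; ⊎⇔∃)
open import Data.Vec.Functional using (_∷_)
open import Data.Empty using (⊥-elim)
open import Data.Product using (Σ; ∃; ∃₂; _×_; _,_; proj₁)
open import Data.Product.Function.NonDependent.Propositional using (_×-⇔_)
import Data.Product.Function.Dependent.Propositional as Σ
open import Data.Sum using (_⊎_; inj₁; inj₂)
open import Data.Sum.Function.Propositional using (_⊎-⇔_)
open import Function using (_∘_)
open import Function.Bundles using (_⇔_; mk⇔; Equivalence)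
open import Function.Properties.Equivalence using (⇔-isEquivalence)
open import Function.Related.Propositional using (K-reflexive)
open import Function.Related.TypeIsomorphisms using (→-cong-⇔; ¬-cong-⇔)
open import Relation.Nullary using (¬_; Dec; yes; no; contradiction)
open import Relation.Binary.PropositionalEquality using (_≡_; _≢_; refl; sym; trans; cong; cong₂; subst)
open import Relation.Binary.Structures using (IsEquivalence; IsDecPartialOrder; IsPartialOrder)

open Equivalence using (to; from)
open IsEquivalence (⇔-isEquivalence {0ℓ}) using ()
  renaming (refl to ⇔-refl; sym to ⇔-sym; trans to ⇔-trans)

Π-cong-⇔ : {A : Set} {P Q : A → Set} → (∀ a → P a ⇔ Q a) → (∀ a → P a) ⇔ (∀ a → Q a)
Π-cong-⇔ P⇔Q = mk⇔ (λ f a → to (P⇔Q a) (f a)) (λ g a → from (P⇔Q a) (g a))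

∃-cong-⇔ : {A : Set} {P Q : A → Set} → (∀ a → P a ⇔ Q a) → ∃ P ⇔ ∃ Q
∃-cong-⇔ P⇔Q = Σ.congˡ (λ {a} → P⇔Q a)

module Correspondence (M N : Str) (_~_ : Carrier M → Carrier N → Set)
  (total : ∀ a → ∃ (a ~_)) (onto : ∀ b → ∃ (_~ b))
  (R-resp : ∀ {a a' b b'} → a ~ b → a' ~ b' → R M a a' ⇔ R N b b')
  (Eq-resp : ∀ {a a' b b'} → a ~ b → a' ~ b' → Eq M a a' ⇔ Eq N b b') where

  ∷-resp : ∀ {k a b} {ρ : Fin k → Carrier M} {ρ' : Fin k → Carrier N} →
           a ~ b → (∀ x → ρ x ~ ρ' x) → ∀ x → (a ∷ ρ) x ~ (b ∷ ρ') x
  ∷-resp a~b ρ~ρ' zero = a~b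
  ∷-resp a~b ρ~ρ' (suc x) = ρ~ρ' x

  sat-⇔ : ∀ {k} (φ : Formula k) {ρ ρ'} → (∀ x → ρ x ~ ρ' x) → Sat M φ ρ ⇔ Sat N φ ρ'
  sat-⇔ (x ≤' y) ρ~ρ' = R-resp (ρ~ρ' x) (ρ~ρ' y)
  sat-⇔ (x ≐' y) ρ~ρ' = Eq-resp (ρ~ρ' x) (ρ~ρ' y)
  sat-⇔ ⊥' ρ~ρ' = ⇔-refl
  sat-⇔ (¬' φ) ρ~ρ' = ¬-cong-⇔ (sat-⇔ φ ρ~ρ')
  sat-⇔ (φ ∧' ψ) ρ~ρ' = sat-⇔ φ ρ~ρ' ×-⇔ sat-⇔ ψ ρ~ρ'
  sat-⇔ (φ ∨' ψ) ρ~ρ' = sat-⇔ φ ρ~ρ' ⊎-⇔ sat-⇔ ψ ρ~ρ'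
  sat-⇔ (φ ⇒' ψ) ρ~ρ' = →-cong-⇔ (sat-⇔ φ ρ~ρ') (sat-⇔ ψ ρ~ρ')
  sat-⇔ (∀' φ) ρ~ρ' = mk⇔
    (λ f b → let (a , a~b) = onto b in to (sat-⇔ φ (∷-resp a~b ρ~ρ')) (f a))
    (λ g a → let (b , a~b) = total a in from (sat-⇔ φ (∷-resp a~b ρ~ρ')) (g b))
  sat-⇔ (∃' φ) ρ~ρ' = mk⇔
    (λ (a , s) → let (b , a~b) = total a in b , to (sat-⇔ φ (∷-resp a~b ρ~ρ')) s)
    (λ (b , s) → let (a , a~b) = onto b in a , from (sat-⇔ φ (∷-resp a~b ρ~ρ')) s)

  ⊨-⇔ : (σ : Sentence) → M ⊨ σ ⇔ N ⊨ σ
  ⊨-⇔ σ = sat-⇔ σ (λ ())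

sat-cong : (M : Str) {k : ℕ} (φ : Formula k) {ρ ρ' : Fin k → Carrier M} →
           (∀ x → ρ x ≡ ρ' x) → Sat M φ ρ ⇔ Sat M φ ρ'
sat-cong M = Correspondence.sat-⇔ M M _≡_ (λ a → a , refl) (λ b → b , refl)
  (λ { refl refl → ⇔-refl }) (λ { refl refl → ⇔-refl })

∷-liftR : {C : Set} {k m : ℕ} {f : Fin k → Fin m} {ρ : Fin m → C} {ρ' : Fin k → C} →
          (∀ x → ρ (f x) ≡ ρ' x) → ∀ a x → (a ∷ ρ) (liftR f x) ≡ (a ∷ ρ') x
∷-liftR ρf≡ρ' a zero = refl
∷-liftR ρf≡ρ' a (suc x) = ρf≡ρ' x

sat-rename : (M : Str) {k m : ℕ} (f : Fin k → Fin m) (φ : Formula k)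
             {ρ : Fin m → Carrier M} {ρ' : Fin k → Carrier M} →
             (∀ x → ρ (f x) ≡ ρ' x) → Sat M (rename f φ) ρ ⇔ Sat M φ ρ'
sat-rename M f (x ≤' y) ρf≡ρ' = K-reflexive (cong₂ (R M) (ρf≡ρ' x) (ρf≡ρ' y))
sat-rename M f (x ≐' y) ρf≡ρ' = K-reflexive (cong₂ (Eq M) (ρf≡ρ' x) (ρf≡ρ' y))
sat-rename M f ⊥' ρf≡ρ' = ⇔-refl
sat-rename M f (¬' φ) ρf≡ρ' = ¬-cong-⇔ (sat-rename M f φ ρf≡ρ')
sat-rename M f (φ ∧' ψ) ρf≡ρ' = sat-rename M f φ ρf≡ρ' ×-⇔ sat-rename M f ψ ρf≡ρ'
sat-rename M f (φ ∨' ψ) ρf≡ρ' = sat-rename M f φ ρf≡ρ' ⊎-⇔ sat-rename M f ψ ρf≡ρ'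
sat-rename M f (φ ⇒' ψ) ρf≡ρ' = →-cong-⇔ (sat-rename M f φ ρf≡ρ') (sat-rename M f ψ ρf≡ρ')
sat-rename M f (∀' φ) ρf≡ρ' = Π-cong-⇔ λ a → sat-rename M (liftR f) φ (∷-liftR ρf≡ρ' a)
sat-rename M f (∃' φ) ρf≡ρ' = ∃-cong-⇔ λ a → sat-rename M (liftR f) φ (∷-liftR ρf≡ρ' a)

sat-⋀ : (M : Str) {m k : ℕ} (f : Fin m → Formula k) {ρ : Fin k → Carrier M} →
        Sat M (⋀ f) ρ ⇔ (∀ j → Sat M (f j) ρ)
sat-⋀ M {zero} f = mk⇔ (λ _ ()) (λ _ ())
sat-⋀ M {suc m} f = ⇔-trans (⇔-refl ×-⇔ sat-⋀ M (f ∘ suc)) ∀-cons-⇔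

sat-⋀² : (M : Str) {m k : ℕ} (f : Fin m → Fin m → Formula k) {ρ : Fin k → Carrier M} →
         Sat M (⋀ λ i → ⋀ (f i)) ρ ⇔ (∀ i j → Sat M (f i j) ρ)
sat-⋀² M f = ⇔-trans (sat-⋀ M _) (Π-cong-⇔ λ i → sat-⋀ M (f i))

sat-⋁ : (M : Str) {m k : ℕ} (f : Fin m → Formula k) {ρ : Fin k → Carrier M} →
        Sat M (⋁ f) ρ ⇔ ∃ λ j → Sat M (f j) ρ
sat-⋁ M {zero} f = mk⇔ (λ ()) (λ ())
sat-⋁ M {suc m} f = ⇔-trans (⇔-refl ⊎-⇔ sat-⋁ M (f ∘ suc)) ⊎⇔∃

⌜_⌝ : {k : ℕ} {P : Set} → Dec P → Formula k
⌜ yes _ ⌝ = ⊤'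
⌜ no _ ⌝ = ⊥'

sat-⌜⌝ : (M : Str) {k : ℕ} {P : Set} (P? : Dec P) {ρ : Fin k → Carrier M} → Sat M ⌜ P? ⌝ ρ ⇔ P
sat-⌜⌝ M (yes p) = mk⇔ (λ _ → p) (λ _ ())
sat-⌜⌝ M (no ¬p) = mk⇔ (λ ()) ¬p

_⇔'_ : {k : ℕ} → Formula k → Formula k → Formula k
φ ⇔' ψ = (φ ⇒' ψ) ∧' (ψ ⇒' φ)

sat-⇔' : (M : Str) {k : ℕ} (φ ψ : Formula k) {ρ : Fin k → Carrier M} →
         Sat M (φ ⇔' ψ) ρ ⇔ (Sat M φ ρ ⇔ Sat M ψ ρ)
sat-⇔' M φ ψ = mk⇔ (λ (f , g) → mk⇔ f g) (λ e → to e , from e)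

∃ⁿ : {m : ℕ} → Formula m → Sentence
∃ⁿ {zero} φ = φ
∃ⁿ {suc m} φ = ∃ⁿ (∃' φ)

⊨-∃ⁿ : (M : Str) {m : ℕ} (φ : Formula m) → M ⊨ ∃ⁿ φ ⇔ ∃ (Sat M φ)
⊨-∃ⁿ M {zero} φ = mk⇔ ((λ ()) ,_) (λ (ρ , s) → to (sat-cong M φ (λ ())) s)
⊨-∃ⁿ M {suc m} φ = ⇔-trans (⊨-∃ⁿ M (∃' φ)) (mk⇔
  (λ (ρ , a , s) → a ∷ ρ , s)
  (λ (ρ , s) → ρ ∘ suc , ρ zero , to (sat-cong M φ λ { zero → refl ; (suc x) → refl }) s))

ElemEquiv⇒satisfiable : {M N : Str} → ElemEquiv M N → {m : ℕ} (φ : Formula m) →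
                        ∃ (Sat M φ) → ∃ (Sat N φ)
ElemEquiv⇒satisfiable {M} {N} M≡N φ = to (⊨-∃ⁿ N φ) ∘ to (M≡N (∃ⁿ φ)) ∘ from (⊨-∃ⁿ M φ)

-- ψ(v, w̄) is the guard; w̄ occupies the last n variables of rel φ.
module Relativisation {n : ℕ} (ψ : Formula (suc n)) where

  guardVars : ∀ k → Fin (suc n) → Fin (suc (k + n))
  guardVars k zero = zero
  guardVars k (suc j) = suc (k ↑ʳ j)

  rel : ∀ {k} → Formula k → Formula (k + n)
  rel (x ≤' y) = (x ↑ˡ n) ≤' (y ↑ˡ n)
  rel (x ≐' y) = (x ↑ˡ n) ≐' (y ↑ˡ n)
  rel ⊥' = ⊥'
  rel (¬' φ) = ¬' rel φ
  rel (φ ∧' χ) = rel φ ∧' rel χ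
  rel (φ ∨' χ) = rel φ ∨' rel χ
  rel (φ ⇒' χ) = rel φ ⇒' rel χ
  rel {k} (∀' φ) = ∀' (rename (guardVars k) ψ ⇒' rel φ)
  rel {k} (∃' φ) = ∃' (rename (guardVars k) ψ ∧' rel φ)

  module _ (M : Str) (w : Fin n → Carrier M) where

    Guard : Carrier M → Set
    Guard y = Sat M ψ (y ∷ w)

    record Agree {k} (ρ : Fin k → Σ (Carrier M) Guard) (ρ' : Fin (k + n) → Carrier M) : Set where
      constructor agree
      field
        onBound : ∀ x → ρ' (x ↑ˡ n) ≡ proj₁ (ρ x)
        onParameters : ∀ j → ρ' (k ↑ʳ j) ≡ w j

    ∷-agree : ∀ {k ρ ρ' c} → Agree {k} ρ ρ' → (g : Guard c) → Agree ((c , g) ∷ ρ) (c ∷ ρ')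
    ∷-agree (agree onBound onParameters) g = agree (λ { zero → refl ; (suc x) → onBound x }) onParameters

    sat-guard : ∀ {k ρ ρ'} → Agree {k} ρ ρ' → ∀ c → Sat M (rename (guardVars k) ψ) (c ∷ ρ') ⇔ Guard c
    sat-guard (agree _ onParameters) c = sat-rename M _ ψ λ { zero → refl ; (suc j) → onParameters j }

    sat-rel : ∀ {k} (φ : Formula k) {ρ ρ'} → Agree ρ ρ' → Sat (SubStr M Guard) φ ρ ⇔ Sat M (rel φ) ρ'
    sat-rel (x ≤' y) (agree onBound _) = K-reflexive (sym (cong₂ (R M) (onBound x) (onBound y)))
    sat-rel (x ≐' y) (agree onBound _) = K-reflexive (sym (cong₂ (Eq M) (onBound x) (onBound y)))
    sat-rel ⊥' ρ≈ρ' = ⇔-refl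
    sat-rel (¬' φ) ρ≈ρ' = ¬-cong-⇔ (sat-rel φ ρ≈ρ')
    sat-rel (φ ∧' χ) ρ≈ρ' = sat-rel φ ρ≈ρ' ×-⇔ sat-rel χ ρ≈ρ'
    sat-rel (φ ∨' χ) ρ≈ρ' = sat-rel φ ρ≈ρ' ⊎-⇔ sat-rel χ ρ≈ρ'
    sat-rel (φ ⇒' χ) ρ≈ρ' = →-cong-⇔ (sat-rel φ ρ≈ρ') (sat-rel χ ρ≈ρ')
    sat-rel (∀' φ) ρ≈ρ' = mk⇔
      (λ f c gc → let g = to (sat-guard ρ≈ρ' c) gc in to (sat-rel φ (∷-agree ρ≈ρ' g)) (f (c , g)))
      (λ f (c , g) → from (sat-rel φ (∷-agree ρ≈ρ' g)) (f c (from (sat-guard ρ≈ρ' c) g)))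
    sat-rel (∃' φ) ρ≈ρ' = mk⇔
      (λ ((c , g) , s) → c , from (sat-guard ρ≈ρ' c) g , to (sat-rel φ (∷-agree ρ≈ρ' g)) s)
      (λ (c , gc , s) → let g = to (sat-guard ρ≈ρ' c) gc in (c , g) , from (sat-rel φ (∷-agree ρ≈ρ' g)) s)

    ⊨-rel : (σ : Sentence) → SubStr M Guard ⊨ σ ⇔ Sat M (rel σ) w
    ⊨-rel σ = sat-rel σ (agree (λ ()) (λ _ → refl))

IsPartition⇒classes : {C : Set} {n : ℕ} {P : Fin n → C → Set} {E : C → C → Set} →
  IsPartition P → (∀ u v → E u v ⇔ ∃ λ i → P i u × P i v) → IsEquivRel E × ClassesAre E P
IsPartition⇒classes {P = P} {E} (cover , disjoint , nonempty) E⇔ =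
  (reflexive , symmetric , transitive) ,
  (λ u → let (i , p) = cover u in i , class p) ,
  (λ i → let (u , p) = nonempty i in u , class p)
  where
  class : ∀ {i u} → P i u → ∀ v → E u v ⇔ P i v
  class {i} {u} p v = mk⇔
    (λ e → let (j , q , s) = to (E⇔ u v) e in subst (λ k → P k v) (disjoint j i u q p) s)
    (λ s → from (E⇔ u v) (i , p , s))
  reflexive : ∀ {x} → E x x
  reflexive {x} = let (i , p) = cover x in from (E⇔ x x) (i , p , p)
  symmetric : ∀ {x y} → E x y → E y x
  symmetric {x} {y} e = let (i , p , q) = to (E⇔ x y) e in from (E⇔ y x) (i , q , p)
  transitive : ∀ {x y z} → E x y → E y z → E x z
  transitive {x} {y} {z} e f = let (i , p , q) = to (E⇔ x y) e in from (class p z) (to (class q z) f)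

module Blocks {n : ℕ} {_≤I_ : Fin n → Fin n → Set} (dpo : IsDecPartialOrder _≡_ _≤I_) where
  open IsDecPartialOrder dpo using (_≤?_)

  v≔w : Fin n → Fin (suc n) → Fin n
  v≔w i zero = i
  v≔w i (suc j) = j

  coverF : Formula n
  coverF = ∀' (⋁ (φ dpo))

  disjointF : Fin n → Fin n → Formula n
  disjointF i j = ∀' ((φ dpo i ∧' φ dpo j) ⇒' ⌜ i ≟ j ⌝)

  rootF : Fin n → Formula n
  rootF i = rename (v≔w i) (φ dpo i)

  -- ∀v ∀u (φ_i(w̄, u) ∧ φ_j(w̄, v) ∧ i ≠ j → (u ≤ v ↔ i ≤I j)), with u the innermost variable
  orderedF : Fin n → Fin n → Formula n
  orderedF i j = ∀' (∀' (((rename (σu dpo) (φ dpo i) ∧' rename (σv dpo) (φ dpo j)) ∧' (¬' ⌜ i ≟ j ⌝))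
                         ⇒' ((zero ≤' suc zero) ⇔' ⌜ i ≤? j ⌝)))

  lexDecompositionF : Formula n
  lexDecompositionF =
    coverF ∧' ((⋀ λ i → ⋀ (disjointF i)) ∧' (⋀ rootF ∧' (⋀ λ i → ⋀ (orderedF i))))

  modelsF : (Fin n → Sentence) → Formula n
  modelsF τ = ⋀ λ i → Relativisation.rel (φ dpo i) (τ i)

  θ : (Fin n → Sentence) → Formula n
  θ τ = lexDecompositionF ∧' modelsF τ

  module _ (M : Str) (w : Fin n → Carrier M) where

    record IsLexDecomposition : Set where
      field
        cover    : (y : Carrier M) → ∃ λ i → D dpo M i w y
        disjoint : (i j : Fin n) (y : Carrier M) → D dpo M i w y → D dpo M j w y → i ≡ j
        root     : (i : Fin n) → D dpo M i w (w i)
        ordered  : ∀ {i j u v} → i ≢ j → D dpo M i w u → D dpo M j w v → R M u v ⇔ i ≤I j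

    sat-σu : (ψ : Formula (suc n)) {u v : Carrier M} →
             Sat M (rename (σu dpo) ψ) (u ∷ v ∷ w) ⇔ Sat M ψ (u ∷ w)
    sat-σu ψ = sat-rename M (σu dpo) ψ λ { zero → refl ; (suc j) → refl }

    sat-σv : (ψ : Formula (suc n)) {u v : Carrier M} →
             Sat M (rename (σv dpo) ψ) (u ∷ v ∷ w) ⇔ Sat M ψ (v ∷ w)
    sat-σv ψ = sat-rename M (σv dpo) ψ λ { zero → refl ; (suc j) → refl }

    sat-ε : ∀ u v → EpsRel dpo M w u v ⇔ ∃ λ i → D dpo M i w u × D dpo M i w v
    sat-ε u v = ⇔-trans (sat-⋁ M _) (∃-cong-⇔ λ i → sat-σu (φ dpo i) ×-⇔ sat-σv (φ dpo i))

    sat-coverF : Sat M coverF w ⇔ ((y : Carrier M) → ∃ λ i → D dpo M i w y)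
    sat-coverF = Π-cong-⇔ λ y → sat-⋁ M (φ dpo)

    sat-disjointF : ∀ i j → Sat M (disjointF i j) w ⇔ ((y : Carrier M) → D dpo M i w y → D dpo M j w y → i ≡ j)
    sat-disjointF i j = mk⇔
      (λ s y p q → to (sat-⌜⌝ M (i ≟ j)) (s y (p , q)))
      (λ d y (p , q) → from (sat-⌜⌝ M (i ≟ j)) (d y p q))

    sat-rootF : ∀ i → Sat M (rootF i) w ⇔ D dpo M i w (w i)
    sat-rootF i = sat-rename M (v≔w i) (φ dpo i) λ { zero → refl ; (suc j) → refl }

    sat-orderedF : ∀ i j → Sat M (orderedF i j) w ⇔
                   (∀ {u v} → i ≢ j → D dpo M i w u → D dpo M j w v → R M u v ⇔ i ≤I j)
    sat-orderedF i j = mk⇔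
      (λ s {u} {v} i≢j p q → ⇔-trans
        (to (sat-⇔' M (zero ≤' suc zero) ⌜ i ≤? j ⌝)
            (s v u ((from (sat-σu (φ dpo i)) p , from (sat-σv (φ dpo j)) q) , i≢j ∘ to (sat-⌜⌝ M (i ≟ j)))))
        (sat-⌜⌝ M (i ≤? j)))
      (λ o v u ((p , q) , i≢j) → from (sat-⇔' M (zero ≤' suc zero) ⌜ i ≤? j ⌝) (⇔-trans
        (o (i≢j ∘ from (sat-⌜⌝ M (i ≟ j))) (to (sat-σu (φ dpo i)) p) (to (sat-σv (φ dpo j)) q))
        (⇔-sym (sat-⌜⌝ M (i ≤? j)))))

    sat-lexDecompositionF : Sat M lexDecompositionF w ⇔ IsLexDecomposition
    sat-lexDecompositionF = mk⇔
      (λ (c , d , rt , o) → record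
        { cover = to sat-coverF c
        ; disjoint = λ i j → to (sat-disjointF i j) (to (sat-⋀² M disjointF) d i j)
        ; root = λ i → to (sat-rootF i) (to (sat-⋀ M rootF) rt i)
        ; ordered = λ {i} {j} → to (sat-orderedF i j) (to (sat-⋀² M orderedF) o i j) })
      (λ L → let open IsLexDecomposition L in
        from sat-coverF cover ,
        from (sat-⋀² M disjointF) (λ i j → from (sat-disjointF i j) (disjoint i j)) ,
        from (sat-⋀ M rootF) (λ i → from (sat-rootF i) (root i)) ,
        from (sat-⋀² M orderedF) (λ i j → from (sat-orderedF i j) ordered))

    sat-modelsF : ∀ τ → Sat M (modelsF τ) w ⇔ (∀ i → SubStr M (D dpo M i w) ⊨ τ i)
    sat-modelsF τ = ⇔-trans (sat-⋀ M _) (Π-cong-⇔ λ i → ⇔-sym (Relativisation.⊨-rel (φ dpo i) M w (τ i)))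

    sat-θ : ∀ τ → Sat M (θ τ) w ⇔ (IsLexDecomposition × (∀ i → SubStr M (D dpo M i w) ⊨ τ i))
    sat-θ τ = sat-lexDecompositionF ×-⇔ sat-modelsF τ

  module _ {M : Str} {w : Fin n → Carrier M} (L : IsLexDecomposition M w) where
    open IsLexDecomposition L

    blocks-partition : IsPartition (λ i → D dpo M i w)
    blocks-partition = cover , disjoint , λ i → w i , root i

    blocks-lexSum : IsLexSumOf _≤I_ (R M) (λ i → D dpo M i w)
    blocks-lexSum u v = mk⇔ split join
      where
      split : R M u v → (∃ λ i → D dpo M i w u × D dpo M i w v × R M u v) ⊎
                        (∃₂ λ i j → (i ≤I j × i ≢ j) × D dpo M i w u × D dpo M j w v)
      split u≤v with cover u | cover v
      ... | i , p | j , q with i ≟ j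
      ...   | yes refl = inj₁ (i , p , q , u≤v)
      ...   | no i≢j = inj₂ (i , j , (to (ordered i≢j p q) u≤v , i≢j) , p , q)
      join : (∃ λ i → D dpo M i w u × D dpo M i w v × R M u v) ⊎
             (∃₂ λ i j → (i ≤I j × i ≢ j) × D dpo M i w u × D dpo M j w v) → R M u v
      join (inj₁ (_ , _ , _ , u≤v)) = u≤v
      join (inj₂ (_ , _ , (i≤j , i≢j) , p , q)) = from (ordered i≢j p q) i≤j

    roots-maximal : ∀ i → IsMaxOf (R M) (D dpo M i w) (w i)
    roots-maximal i = root i , λ y → proj₁

module SumOrder {n : ℕ} {_≤I_ : Fin n → Fin n → Set} (dpo : IsDecPartialOrder _≡_ _≤I_)
                {Xs : Fin n → Set} {le : (i : Fin n) → Xs i → Xs i → Set} where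

  SumLe-within : ∀ {i} {x y : Xs i} → SumLe dpo Xs le (i , x) (i , y) ⇔ le i x y
  SumLe-within = mk⇔ (λ { (same x≤y) → x≤y ; (less _ i≢i) → contradiction refl i≢i }) same

  SumLe-across : ∀ {i j} {x : Xs i} {y : Xs j} → i ≢ j → SumLe dpo Xs le (i , x) (j , y) ⇔ i ≤I j
  SumLe-across i≢j = mk⇔ (λ { (same _) → contradiction refl i≢j ; (less i≤j _) → i≤j }) (λ i≤j → less i≤j i≢j)

module RootedSum {n : ℕ} {_≤I_ : Fin n → Fin n → Set} (dpo : IsDecPartialOrder _≡_ _≤I_)
  (Xs : Fin n → Set) (le : (i : Fin n) → Xs i → Xs i → Set)
  (po : (i : Fin n) → IsPartialOrder _≡_ (le i))
  (r : (i : Fin n) → Xs i) (rmax : (i : Fin n) (x : Xs i) → le i x (r i)) where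

  open IsDecPartialOrder dpo using (_≤?_)
  open SumOrder dpo
  open Blocks dpo

  X : Str
  X = SumStr dpo Xs le

  r̄ : Fin n → Σ (Fin n) Xs
  r̄ i = i , r i

  D-intro : (i : Fin n) (a : Xs i) → D dpo X i r̄ (i , a)
  D-intro i a = same (rmax i a) , from (sat-⋀ X _) (λ j → clause-holds j (j ≟ i))
    where
    clause-holds : ∀ j (j≟i : Dec (j ≡ i)) → Sat X (clause dpo i j j≟i) ((i , a) ∷ r̄)
    clause-holds j (yes _) = λ ()
    clause-holds j (no j≢i) = clauseD-holds (j ≤? i) (i ≤? j)
      where
      clauseD-holds : (j≤?i : Dec (j ≤I i)) (i≤?j : Dec (i ≤I j)) → Sat X (clauseD dpo i j j≤?i i≤?j) ((i , a) ∷ r̄)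
      clauseD-holds (yes j≤i) _ = less j≤i j≢i , j≢i ∘ cong proj₁
      clauseD-holds (no _) (yes i≤j) = less i≤j (j≢i ∘ sym) , j≢i ∘ sym ∘ cong proj₁
      clauseD-holds (no j≰i) (no i≰j) = j≰i ∘ to (SumLe-across j≢i) , i≰j ∘ to (SumLe-across (j≢i ∘ sym))

  -- For a ∈ X_k with k <I i, the clause of φ_i for w_k demands r_k < a, against the maximality of r_k.
  D-elim : ∀ {i k} {a : Xs k} → D dpo X i r̄ (k , a) → k ≡ i
  D-elim (same _ , _) = refl
  D-elim {i} {k} {a} (less k≤i k≢i , clauses) = ⊥-elim (no-clause (k ≟ i) (to (sat-⋀ X _) clauses k))
    where
    no-clause : (k≟i : Dec (k ≡ i)) → ¬ Sat X (clause dpo i k k≟i) ((k , a) ∷ r̄)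
    no-clause (yes k≡i) _ = k≢i k≡i
    no-clause (no _) = no-clauseD (k ≤? i) (i ≤? k)
      where
      no-clauseD : (k≤?i : Dec (k ≤I i)) (i≤?k : Dec (i ≤I k)) → ¬ Sat X (clauseD dpo i k k≤?i i≤?k) ((k , a) ∷ r̄)
      no-clauseD (yes _) _ (rₖ≤a , rₖ≢a) =
        rₖ≢a (cong (k ,_) (IsPartialOrder.antisym (po k) (to SumLe-within rₖ≤a) (rmax k a)))
      no-clauseD (no k≰i) _ _ = k≰i k≤i

  block⇔D : (i : Fin n) (x : Σ (Fin n) Xs) → (proj₁ x ≡ i) ⇔ D dpo X i r̄ x
  block⇔D i (k , a) = mk⇔ (λ { refl → D-intro k a }) D-elim

  lexDecomposition : IsLexDecomposition X r̄
  lexDecomposition = record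
    { cover = λ (k , a) → k , D-intro k a
    ; disjoint = λ i j (k , a) p q → trans (sym (D-elim p)) (D-elim q)
    ; root = λ i → D-intro i (r i)
    ; ordered = λ i≢j p q → ordered′ i≢j (D-elim p) (D-elim q) }
    where
    ordered′ : ∀ {i j k l} {a : Xs k} {b : Xs l} → i ≢ j → k ≡ i → l ≡ j →
               SumLe dpo Xs le (k , a) (l , b) ⇔ i ≤I j
    ordered′ i≢j refl refl = SumLe-across i≢j

  block-≅ : (i : Fin n) (σ : Sentence) → mkStr (Xs i) (le i) ⊨ σ ⇔ SubStr X (D dpo X i r̄) ⊨ σ
  block-≅ i = Correspondence.⊨-⇔ (mkStr (Xs i) (le i)) (SubStr X (D dpo X i r̄)) _~_
    (λ a → ((i , a) , D-intro i a) , embed) onto R-resp Eq-resp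
    where
    data _~_ (a : Xs i) : Σ (Σ (Fin n) Xs) (D dpo X i r̄) → Set where
      embed : ∀ {p} → a ~ ((i , a) , p)
    onto : ∀ b → ∃ (_~ b)
    onto ((k , b) , p) with D-elim p
    ... | refl = b , embed
    R-resp : ∀ {a a' b b'} → a ~ b → a' ~ b' → le i a a' ⇔ SumLe dpo Xs le (proj₁ b) (proj₁ b')
    R-resp embed embed = ⇔-sym SumLe-within
    Eq-resp : ∀ {a a' b b'} → a ~ b → a' ~ b' → a ≡ a' ⇔ proj₁ b ≡ proj₁ b'
    Eq-resp embed embed = mk⇔ (cong (i ,_)) λ { refl → refl }

  index-partition : IsPartition (λ i (x : Σ (Fin n) Xs) → proj₁ x ≡ i)
  index-partition = (λ x → proj₁ x , refl) , (λ i j y p q → trans (sym p) q) , (λ i → r̄ i , refl)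

  ε⇔sameIndex : ∀ u v → EpsRel dpo X r̄ u v ⇔ ∃ λ i → proj₁ u ≡ i × proj₁ v ≡ i
  ε⇔sameIndex u v = ⇔-trans (sat-ε X r̄ u v) (∃-cong-⇔ λ i → ⇔-sym (block⇔D i u) ×-⇔ ⇔-sym (block⇔D i v))

theorem3p1 : {n : ℕ} {_≤I_ : Fin n → Fin n → Set}
    (dpo : IsDecPartialOrder _≡_ _≤I_)
    (Xs : Fin n → Set) (le : (i : Fin n) → Xs i → Xs i → Set)
    (po : (i : Fin n) → IsPartialOrder _≡_ (le i))
    (r : (i : Fin n) → Xs i) (rmax : (i : Fin n) (x : Xs i) → le i x (r i)) →
    let X = SumStr dpo Xs le
        rbar = λ (i : Fin n) → (i , r i)
    in
    -- (a)
    ((i : Fin n) (x : Σ (Fin n) Xs) → (proj₁ x ≡ i) ⇔ D dpo X i rbar x)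
    -- (b)
    × (IsEquivRel (EpsRel dpo X rbar)
       × ClassesAre (EpsRel dpo X rbar) (λ i x → proj₁ x ≡ i))
    -- (c)
    × ((Y : Set) (_≤Y_ : Y → Y → Set) → ElemEquiv X (mkStr Y _≤Y_) →
       (τ : Fin n → Sentence) → ((i : Fin n) → mkStr (Xs i) (le i) ⊨ τ i) →
       Σ (Fin n → Y) λ r' →
         let 𝕐 = mkStr Y _≤Y_
             Yi = λ (i : Fin n) → D dpo 𝕐 i r'
         in
         -- (i)
         (IsPartition Yi
          × IsEquivRel (EpsRel dpo 𝕐 r')
          × ClassesAre (EpsRel dpo 𝕐 r') Yi)
         -- (ii)
         × (IsLexSumOf _≤I_ _≤Y_ Yi
            × ((i : Fin n) → IsMaxOf _≤Y_ (Yi i) (r' i)))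
         -- (iii)
         × ((i : Fin n) → SubStr 𝕐 (Yi i) ⊨ τ i))
theorem3p1 dpo Xs le po r rmax =
  block⇔D ,
  IsPartition⇒classes index-partition ε⇔sameIndex ,
  λ Y _≤Y_ X≡Y τ Xᵢ⊨τ →
    let 𝕐 = mkStr Y _≤Y_
        (r' , 𝕐⊨θ) = ElemEquiv⇒satisfiable X≡Y (θ τ)
                       (r̄ , from (sat-θ X r̄ τ) (lexDecomposition , λ i → to (block-≅ i (τ i)) (Xᵢ⊨τ i)))
        (L , 𝕐ᵢ⊨τ) = to (sat-θ 𝕐 r' τ) 𝕐⊨θ
    in r' ,
       (blocks-partition L , IsPartition⇒classes (blocks-partition L) (sat-ε 𝕐 r')) ,
       (blocks-lexSum L , roots-maximal L) ,
       𝕐ᵢ⊨τ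
  where
  open Blocks dpo
  open RootedSum dpo Xs le po r rmax
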